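{- Let $m\geq 3$ and let $G=\Theta(s_1^{m-1},s_2)$ be the generalized theta graph with $m-1$ paths having $s_1$ internal vertices and one path having $s_2>s_1$ internal vertices. Then $\beta(G)\geq m-1$.
   Context: Graphs are simple, connected, finite. A set $W\subseteq V(G)$ is resolving if for any distinct $u,v$ there is $w\in W$ with $d(u,w)\ne d(v,w)$; $\beta(G)$ is the minimum size of a resolving set. A generalized theta graph consists of two vertices $c_1,c_2$ (centers) joined by internally disjoint paths; a path with $s$ internal vertices has length $s+1$. -}

module Defs where

open import Data.Nat using (ℕ; zero; suc; _≤_; _<?_)
open import Data.Fin using (Fin; fromℕ<)
open import Data.Product using (Σ; _×_; ∃)
open import Data.Sum using (_⊎_)
open import Data.List using (List)
open import Data.List.Membership.Propositional using (_∈_)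
open import Relation.Nullary using (¬_; yes; no)
open import Relation.Binary.PropositionalEquality using (_≡_; _≢_)

record Graph : Set₁ where
  field
    V   : Set
    Adj : V → V → Set
open Graph public

data Walk (G : Graph) : V G → V G → ℕ → Set where
  here : ∀ {u} → Walk G u u zero
  step : ∀ {u v w n} → Adj G u v → Walk G v w n → Walk G u w (suc n)

IsDist : (G : Graph) → V G → V G → ℕ → Set
IsDist G u v d = Walk G u v d × (∀ d' → Walk G u v d' → d ≤ d')

Resolving : (G : Graph) → List (V G) → Set
Resolving G W =
  ∀ u v → u ≢ v →
  Σ (V G) λ w → w ∈ W × Σ ℕ λ d → Σ ℕ λ d' →
    IsDist G u w d × IsDist G v w d' × d ≢ d'

-- Vertices of the generalized theta graph Θ(s₁^k, s₂):
-- centers c₁ c₂, internal vertices of the k short paths, of the long path.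
data ThetaV (k s₁ s₂ : ℕ) : Set where
  c₁ c₂ : ThetaV k s₁ s₂
  short : Fin k → Fin s₁ → ThetaV k s₁ s₂
  long  : Fin s₂ → ThetaV k s₁ s₂

-- Position p along a path with s internal vertices f 0 … f (s-1):
-- position 0 is a, positions 1..s are the internal vertices, s+1 is b.
pathAt : {A : Set} → A → A → (s : ℕ) → (Fin s → A) → ℕ → A
pathAt a b s f zero = a
pathAt a b s f (suc p) with p <? s
... | yes p<s = f (fromℕ< p<s)
... | no _ = b

data ThetaEdge (k s₁ s₂ : ℕ) : ThetaV k s₁ s₂ → ThetaV k s₁ s₂ → Set where
  shortE : (i : Fin k) (p : ℕ) → p ≤ s₁ →
    ThetaEdge k s₁ s₂ (pathAt c₁ c₂ s₁ (short i) p) (pathAt c₁ c₂ s₁ (short i) (suc p))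
  longE : (p : ℕ) → p ≤ s₂ →
    ThetaEdge k s₁ s₂ (pathAt c₁ c₂ s₂ long p) (pathAt c₁ c₂ s₂ long (suc p))

Theta : (k s₁ s₂ : ℕ) → Graph
Theta k s₁ s₂ = record
  { V = ThetaV k s₁ s₂
  ; Adj = λ u v → ThetaEdge k s₁ s₂ u v ⊎ ThetaEdge k s₁ s₂ v u }

-- Let k = m - 1 and suppose W resolves Θ(s₁^k, s₂). Two short paths that both avoid W are
-- exchanged by the automorphism swapping them, which fixes W, so their first vertices are not
-- resolved; hence at most one short path i avoids W. If one does, consider its first vertex u
-- and the first vertex v of the long path, both adjacent to c₁. A vertex at position p on
-- another short path lies at distance p + 1 from both (a 1-Lipschitz potential vanishing there
-- gives the lower bound; s₁ ≤ s₂ rules out a shortcut through the long path), so the vertex of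
-- W resolving u and v lies on no short path. Either way W has k distinct members, one per path.
module Submission where

open import Defs
open import Data.Nat using (ℕ; _≤_; _<_; _∸_)
open import Data.List using (List; length)
open import Data.List.Relation.Unary.Unique.Propositional using (Unique)

open import Data.Nat using (zero; suc; _+_; _⊓_; z≤n; s≤s; _<?_; ∣_-_∣)
open import Data.Nat.Properties hiding (_≟_)
open import Data.Fin using (Fin; toℕ; _≟_) renaming (zero to 0F)
open import Data.Fin.Properties using (toℕ<n; toℕ-fromℕ<; fromℕ<-toℕ; injective⇒≤; all?; ¬∀⟶∃¬)
open import Data.Fin.Permutation.Components using (transpose)
open import Data.List using (lookup)
open import Data.List.Relation.Unary.Any as Any using (Any; index)
open import Data.List.Relation.Unary.Any.Properties using (lookup-index)
open import Data.List.Membership.Propositional using (_∈_; lose)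
open import Data.Product using (_×_; _,_; proj₁; proj₂)
open import Data.Sum using (_⊎_; inj₁; inj₂)
open import Data.Empty using (⊥-elim)
open import Relation.Nullary using (¬_; Dec; yes; no)
open import Relation.Nullary.Decidable using (dec-true; dec-false)
open import Relation.Binary.PropositionalEquality
open import Function using (_∘_)

length-≥-labels : {A : Set} {k : ℕ} (W : List A) (P : Fin k → A → Set) →
  (∀ {x y a} → P x a → P y a → x ≡ y) → (∀ x → Any (P x) W) → k ≤ length W
length-≥-labels W P unique labelled = injective⇒≤ index-injective
  where
  index-injective : ∀ {x y} → index (labelled x) ≡ index (labelled y) → x ≡ y
  index-injective {x} {y} eq = unique
    (subst (P x ∘ lookup W) eq (lookup-index (labelled x))) (lookup-index (labelled y))

transpose-matchˡ : ∀ {n} (i j : Fin n) → transpose i j i ≡ j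
transpose-matchˡ i j rewrite dec-true (i ≟ i) refl = refl

transpose-matchʳ : ∀ {n} (i j : Fin n) → transpose i j j ≡ i
transpose-matchʳ i j with j ≟ i
... | yes j≡i = j≡i
... | no _ rewrite dec-true (j ≟ j) refl = refl

transpose-fix : ∀ {n} {i j x : Fin n} → x ≢ i → x ≢ j → transpose i j x ≡ x
transpose-fix {i = i} {j} {x} x≢i x≢j rewrite dec-false (x ≟ i) x≢i | dec-false (x ≟ j) x≢j = refl

∣m-n∣≤1+∣m-1+n∣ : ∀ m n → ∣ m - n ∣ ≤ suc ∣ m - suc n ∣
∣m-n∣≤1+∣m-1+n∣ zero n = m≤n⇒m≤1+n (n≤1+n n)
∣m-n∣≤1+∣m-1+n∣ (suc m) zero = s≤s (≤-reflexive (sym (∣-∣-identityʳ m)))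
∣m-n∣≤1+∣m-1+n∣ (suc m) (suc n) = ∣m-n∣≤1+∣m-1+n∣ m n

∣m-1+n∣≤1+∣m-n∣ : ∀ m n → ∣ m - suc n ∣ ≤ suc ∣ m - n ∣
∣m-1+n∣≤1+∣m-n∣ zero n = ≤-refl
∣m-1+n∣≤1+∣m-n∣ (suc m) zero = ≤-trans (≤-reflexive (∣-∣-identityʳ m)) (m≤n⇒m≤1+n (n≤1+n m))
∣m-1+n∣≤1+∣m-n∣ (suc m) (suc n) = ∣m-1+n∣≤1+∣m-n∣ m n

LipschitzUpTo : ℕ → (ℕ → ℕ) → Set
LipschitzUpTo s ρ = ∀ q → q ≤ s → ρ q ≤ suc (ρ (suc q)) × ρ (suc q) ≤ suc (ρ q)

∣-∣-lipschitz : ∀ m s → LipschitzUpTo s (∣ m -_∣)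
∣-∣-lipschitz m s q _ = ∣m-n∣≤1+∣m-1+n∣ m q , ∣m-1+n∣≤1+∣m-n∣ m q

-- The distance to a vertex at distance p from c₁ and c from c₂, from position q of a path
-- with Λ internal vertices that avoids it.
detour : (p c Λ q : ℕ) → ℕ
detour p c Λ q = (p + q) ⊓ (c + (suc Λ ∸ q))

detour-lipschitz : ∀ p c Λ → LipschitzUpTo Λ (detour p c Λ)
detour-lipschitz p c Λ q q≤Λ =
  ⊓-mono-≤ (m≤n⇒m≤1+n (+-monoʳ-≤ p (n≤1+n q)))
           (≤-reflexive (trans (cong (c +_) (+-∸-assoc 1 q≤Λ)) (+-suc c (Λ ∸ q))))
  , ⊓-mono-≤ (≤-reflexive (+-suc p q))
             (m≤n⇒m≤1+n (+-monoʳ-≤ c (∸-monoˡ-≤ q (n≤1+n Λ))))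

detour-start : ∀ p c Λ → p ≤ c + suc Λ → detour p c Λ 0 ≡ p
detour-start p c Λ p≤ = trans (cong (_⊓ _) (+-identityʳ p)) (m≤n⇒m⊓n≡m p≤)

detour-end : ∀ p c Λ → c ≤ p + suc Λ → detour p c Λ (suc Λ) ≡ c
detour-end p c Λ c≤ rewrite n∸n≡0 Λ | +-identityʳ c = m≥n⇒m⊓n≡n c≤

detour-second : ∀ p c Λ → suc p ≤ c + Λ → suc p ≤ detour p c Λ 1
detour-second p c Λ 1+p≤ = ⊓-glb (≤-reflexive (+-comm 1 p)) 1+p≤

Lipschitz : (G : Graph) → (V G → ℕ) → Set
Lipschitz G φ = ∀ {x y} → Adj G x y → φ x ≤ suc (φ y)

module _ {G : Graph} where

  walk-along : (P : ℕ → V G) (n : ℕ) → (∀ q → q < n → Adj G (P q) (P (suc q))) →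
    Walk G (P 0) (P n) n
  walk-along P zero adj = here
  walk-along P (suc n) adj = step (adj 0 (s≤s z≤n)) (walk-along (P ∘ suc) n (λ q → adj (suc q) ∘ s≤s))

  walk-map : (σ : V G → V G) → (∀ {x y} → Adj G x y → Adj G (σ x) (σ y)) →
    ∀ {x y n} → Walk G x y n → Walk G (σ x) (σ y) n
  walk-map σ hom here = here
  walk-map σ hom (step e w) = step (hom e) (walk-map σ hom w)

  walk-length-≥-potential : {φ : V G → ℕ} → Lipschitz G φ →
    ∀ {x y n} → Walk G x y n → φ x ≤ n + φ y
  walk-length-≥-potential lip here = ≤-refl
  walk-length-≥-potential lip (step e w) = ≤-trans (lip e) (s≤s (walk-length-≥-potential lip w))

  potential≤dist : {φ : V G → ℕ} → Lipschitz G φ → ∀ {x y d} → φ y ≡ 0 → IsDist G x y d → φ x ≤ d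
  potential≤dist {φ} lip {x} {d = d} φy≡0 (walk , _) =
    subst (φ x ≤_) (trans (cong (d +_) φy≡0) (+-identityʳ d)) (walk-length-≥-potential lip walk)

  dist-≤-preimage : (σ : V G → V G) → (∀ {x y} → Adj G x y → Adj G (σ x) (σ y)) →
    ∀ {x y d d'} → IsDist G x y d → IsDist G (σ x) (σ y) d' → d' ≤ d
  dist-≤-preimage σ hom (walk , _) (_ , minimal) = minimal _ (walk-map σ hom walk)

  dist-swapped : (σ : V G → V G) → (∀ {x y} → Adj G x y → Adj G (σ x) (σ y)) →
    ∀ {a b w d d'} → σ a ≡ b → σ b ≡ a → σ w ≡ w → IsDist G a w d → IsDist G b w d' → d ≡ d'
  dist-swapped σ hom σa≡b σb≡a σw≡w Da Db = ≤-antisym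
    (dist-≤-preimage σ hom Db (subst₂ (λ x y → IsDist G x y _) (sym σb≡a) (sym σw≡w) Da))
    (dist-≤-preimage σ hom Da (subst₂ (λ x y → IsDist G x y _) (sym σa≡b) (sym σw≡w) Db))

module _ {A : Set} where

  pathAt-map : {B : Set} (h : A → B) (a b : A) (s : ℕ) (f : Fin s → A) (q : ℕ) →
    h (pathAt a b s f q) ≡ pathAt (h a) (h b) s (h ∘ f) q
  pathAt-map h a b s f zero = refl
  pathAt-map h a b s f (suc q) with q <? s
  ... | yes _ = refl
  ... | no _ = refl

  pathAt-toℕ : (a b : A) (s : ℕ) (f : Fin s → A) (t : Fin s) → pathAt a b s f (suc (toℕ t)) ≡ f t
  pathAt-toℕ a b s f t with toℕ t <? s
  ... | yes t<s = cong f (fromℕ<-toℕ t t<s)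
  ... | no t≮s = ⊥-elim (t≮s (toℕ<n t))

  record Traces (φ : A → ℕ) (a b : A) (s : ℕ) (f : Fin s → A) (ρ : ℕ → ℕ) : Set where
    field
      at-start    : φ a ≡ ρ 0
      at-end      : φ b ≡ ρ (suc s)
      at-interior : ∀ t → φ (f t) ≡ ρ (suc (toℕ t))

  pathAt-traced : ∀ {φ a b s f ρ} → Traces φ a b s f ρ → ∀ q → q ≤ suc s → φ (pathAt a b s f q) ≡ ρ q
  pathAt-traced traces zero _ = Traces.at-start traces
  pathAt-traced {s = s} {ρ = ρ} traces (suc q) q<1+s with q <? s
  ... | yes q<s = trans (Traces.at-interior traces _) (cong (ρ ∘ suc) (toℕ-fromℕ< q<s))
  ... | no q≮s = trans (Traces.at-end traces) (cong (ρ ∘ suc) (≤-antisym (≮⇒≥ q≮s) (≤-pred q<1+s)))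

  lipschitz-along : ∀ {φ a b s f ρ} → Traces φ a b s f ρ → LipschitzUpTo s ρ →
    LipschitzUpTo s (φ ∘ pathAt a b s f)
  lipschitz-along traces lip q q≤s =
    subst₂ (λ x y → x ≤ suc y × y ≤ suc x)
      (sym (pathAt-traced traces q (m≤n⇒m≤1+n q≤s))) (sym (pathAt-traced traces (suc q) (s≤s q≤s)))
      (lip q q≤s)

module _ {k s₁ s₂ : ℕ} where

  data OnShort (i : Fin k) : ThetaV k s₁ s₂ → Set where
    short : ∀ t → OnShort i (short i t)

  onShort? : ∀ i v → Dec (OnShort i v)
  onShort? i c₁ = no λ ()
  onShort? i c₂ = no λ ()
  onShort? i (long _) = no λ ()
  onShort? i (short j t) with j ≟ i
  ... | yes refl = yes (short t)
  ... | no j≢i = no λ { (short t) → j≢i refl }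

  onShort-unique : ∀ {i j v} → OnShort i v → OnShort j v → i ≡ j
  onShort-unique (short t) (short t) = refl

  OffShort : ThetaV k s₁ s₂ → Set
  OffShort v = ∀ i → ¬ OnShort i v

  relabel : (Fin k → Fin k) → ThetaV k s₁ s₂ → ThetaV k s₁ s₂
  relabel τ c₁ = c₁
  relabel τ c₂ = c₂
  relabel τ (short i t) = short (τ i) t
  relabel τ (long t) = long t

  relabel-edge : ∀ τ {x y} → ThetaEdge k s₁ s₂ x y → ThetaEdge k s₁ s₂ (relabel τ x) (relabel τ y)
  relabel-edge τ (shortE i q q≤s) = subst₂ (ThetaEdge k s₁ s₂)
    (sym (pathAt-map (relabel τ) c₁ c₂ s₁ (short i) q)) (sym (pathAt-map (relabel τ) c₁ c₂ s₁ (short i) (suc q)))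
    (shortE (τ i) q q≤s)
  relabel-edge τ (longE q q≤s) = subst₂ (ThetaEdge k s₁ s₂)
    (sym (pathAt-map (relabel τ) c₁ c₂ s₂ long q)) (sym (pathAt-map (relabel τ) c₁ c₂ s₂ long (suc q)))
    (longE q q≤s)

  relabel-adj : ∀ τ {x y} → Adj (Theta k s₁ s₂) x y → Adj (Theta k s₁ s₂) (relabel τ x) (relabel τ y)
  relabel-adj τ (inj₁ e) = inj₁ (relabel-edge τ e)
  relabel-adj τ (inj₂ e) = inj₂ (relabel-edge τ e)

  relabel-transpose-fix : ∀ {i j} v → ¬ OnShort i v → ¬ OnShort j v → relabel (transpose i j) v ≡ v
  relabel-transpose-fix c₁ _ _ = refl
  relabel-transpose-fix c₂ _ _ = refl
  relabel-transpose-fix (long _) _ _ = refl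
  relabel-transpose-fix (short x t) ¬i ¬j =
    cong (λ y → short y t) (transpose-fix (λ { refl → ¬i (short t) }) (λ { refl → ¬j (short t) }))

  theta-lipschitz : (φ : ThetaV k s₁ s₂ → ℕ) →
    (∀ i → LipschitzUpTo s₁ (φ ∘ pathAt c₁ c₂ s₁ (short i))) → LipschitzUpTo s₂ (φ ∘ pathAt c₁ c₂ s₂ long) →
    Lipschitz (Theta k s₁ s₂) φ
  theta-lipschitz φ lip-short lip-long (inj₁ (shortE i q q≤s)) = proj₁ (lip-short i q q≤s)
  theta-lipschitz φ lip-short lip-long (inj₁ (longE q q≤s)) = proj₁ (lip-long q q≤s)
  theta-lipschitz φ lip-short lip-long (inj₂ (shortE i q q≤s)) = proj₂ (lip-short i q q≤s)
  theta-lipschitz φ lip-short lip-long (inj₂ (longE q q≤s)) = proj₂ (lip-long q q≤s)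

-- Distances to the vertex at position p = 1 + toℕ t of the short path j, via a potential that
-- is the true distance off path j and |p - q| on it.
module DistanceToShort {k s l : ℕ} (s≤l : s ≤ l) (j : Fin k) (t : Fin (suc s)) where

  Θ : Graph
  Θ = Theta k (suc s) (suc l)

  p : ℕ
  p = suc (toℕ t)

  c : ℕ
  c = suc (suc s) ∸ p

  p≤1+s : p ≤ suc s
  p≤1+s = toℕ<n t

  module _ {Λ : ℕ} (1+s≤Λ : suc s ≤ Λ) where

    detour-start-condition : p ≤ c + suc Λ
    detour-start-condition = ≤-trans p≤1+s (≤-trans 1+s≤Λ (≤-trans (n≤1+n Λ) (m≤n+m (suc Λ) c)))

    detour-end-condition : c ≤ p + suc Λ
    detour-end-condition = ≤-trans (m∸n≤m (suc (suc s)) p) (≤-trans (s≤s 1+s≤Λ) (m≤n+m (suc Λ) p))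

    detour-second-condition : suc p ≤ c + Λ
    detour-second-condition = +-mono-≤ (m<n⇒0<n∸m (s≤s p≤1+s)) (≤-trans p≤1+s 1+s≤Λ)

  shortProfile : ∀ {i} → Dec (i ≡ j) → ℕ → ℕ
  shortProfile (yes _) = ∣ p -_∣
  shortProfile (no _) = detour p c (suc s)

  shortProfile-start : ∀ {i} (i≟j : Dec (i ≡ j)) → shortProfile i≟j 0 ≡ p
  shortProfile-start (yes _) = ∣-∣-identityʳ p
  shortProfile-start (no _) = detour-start p c (suc s) (detour-start-condition ≤-refl)

  shortProfile-end : ∀ {i} (i≟j : Dec (i ≡ j)) → shortProfile i≟j (suc (suc s)) ≡ c
  shortProfile-end (yes _) = m≤n⇒∣m-n∣≡n∸m (m≤n⇒m≤1+n p≤1+s)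
  shortProfile-end (no _) = detour-end p c (suc s) (detour-end-condition ≤-refl)

  shortProfile-lipschitz : ∀ {i} (i≟j : Dec (i ≡ j)) → LipschitzUpTo (suc s) (shortProfile i≟j)
  shortProfile-lipschitz (yes _) = ∣-∣-lipschitz p (suc s)
  shortProfile-lipschitz (no _) = detour-lipschitz p c (suc s)

  φ : ThetaV k (suc s) (suc l) → ℕ
  φ c₁ = p
  φ c₂ = c
  φ (short i u) = shortProfile (i ≟ j) (suc (toℕ u))
  φ (long u) = detour p c (suc l) (suc (toℕ u))

  φ-traces-short : ∀ i → Traces φ c₁ c₂ (suc s) (short i) (shortProfile (i ≟ j))
  φ-traces-short i = record
    { at-start = sym (shortProfile-start (i ≟ j))
    ; at-end = sym (shortProfile-end (i ≟ j))
    ; at-interior = λ _ → refl }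

  φ-traces-long : Traces φ c₁ c₂ (suc l) long (detour p c (suc l))
  φ-traces-long = record
    { at-start = sym (detour-start p c (suc l) (detour-start-condition (s≤s s≤l)))
    ; at-end = sym (detour-end p c (suc l) (detour-end-condition (s≤s s≤l)))
    ; at-interior = λ _ → refl }

  φ-lipschitz : Lipschitz Θ φ
  φ-lipschitz = theta-lipschitz φ
    (λ i → lipschitz-along (φ-traces-short i) (shortProfile-lipschitz (i ≟ j)))
    (lipschitz-along φ-traces-long (detour-lipschitz p c (suc l)))

  φ-target : φ (short j t) ≡ 0
  φ-target with j ≟ j
  ... | yes _ = ∣n-n∣≡0 p
  ... | no j≢j = ⊥-elim (j≢j refl)

  walk-from-c₁ : Walk Θ c₁ (short j t) p
  walk-from-c₁ = subst (λ v → Walk Θ c₁ v p) (pathAt-toℕ c₁ c₂ (suc s) (short j) t)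
    (walk-along (pathAt c₁ c₂ (suc s) (short j)) p
      (λ q q<p → inj₁ (shortE j q (<⇒≤ (≤-trans q<p p≤1+s)))))

  dist-from-short-first : ∀ {i d} → i ≢ j → IsDist Θ (short i 0F) (short j t) d → d ≡ suc p
  dist-from-short-first {i} i≢j D@(_ , minimal) =
    ≤-antisym (minimal _ (step (inj₂ (shortE i 0 z≤n)) walk-from-c₁))
              (≤-trans φ-short-first (potential≤dist φ-lipschitz φ-target D))
    where
    φ-short-first : suc p ≤ φ (short i 0F)
    φ-short-first with i ≟ j
    ... | yes i≡j = ⊥-elim (i≢j i≡j)
    ... | no _ = detour-second p c (suc s) (detour-second-condition ≤-refl)

  dist-from-long-first : ∀ {d} → IsDist Θ (long 0F) (short j t) d → d ≡ suc p
  dist-from-long-first D@(_ , minimal) =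
    ≤-antisym (minimal _ (step (inj₂ (longE 0 z≤n)) walk-from-c₁))
              (≤-trans (detour-second p c (suc l) (detour-second-condition (s≤s s≤l)))
                       (potential≤dist φ-lipschitz φ-target D))

missed-short-paths-equal : ∀ {k s s₂} {W : List (ThetaV k (suc s) s₂)} {i j} →
  Resolving (Theta k (suc s) s₂) W → ¬ Any (OnShort i) W → ¬ Any (OnShort j) W → i ≡ j
missed-short-paths-equal {i = i} {j} resolves i-missed j-missed with i ≟ j
... | yes i≡j = i≡j
... | no i≢j with resolves (short i 0F) (short j 0F) (λ { refl → i≢j refl })
...   | w , w∈W , _ , _ , Du , Dv , d≢d' = ⊥-elim (d≢d' (dist-swapped
        (relabel (transpose i j)) (relabel-adj (transpose i j))
        (cong (λ x → short x 0F) (transpose-matchˡ i j)) (cong (λ x → short x 0F) (transpose-matchʳ i j))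
        (relabel-transpose-fix w (i-missed ∘ lose w∈W) (j-missed ∘ lose w∈W)) Du Dv))

module _ {k s l : ℕ} (s≤l : s ≤ l) where

  on-other-short-equidistant : ∀ {i x w d d'} → x ≢ i → OnShort x w →
    IsDist (Theta k (suc s) (suc l)) (short i 0F) w d → IsDist (Theta k (suc s) (suc l)) (long 0F) w d' → d ≡ d'
  on-other-short-equidistant {x = x} x≢i (short t) Du Dv =
    trans (dist-from-short-first (x≢i ∘ sym) Du) (sym (dist-from-long-first Dv))
    where open DistanceToShort s≤l x t

  resolver-off-short : ∀ {W i w d d'} → ¬ Any (OnShort i) W → w ∈ W →
    IsDist (Theta k (suc s) (suc l)) (short i 0F) w d → IsDist (Theta k (suc s) (suc l)) (long 0F) w d' →
    d ≢ d' → OffShort w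
  resolver-off-short {i = i} i-missed w∈W Du Dv d≢d' x on-x with x ≟ i
  ... | yes refl = i-missed (lose w∈W on-x)
  ... | no x≢i = d≢d' (on-other-short-equidistant x≢i on-x Du Dv)

  resolving-length : (W : List (ThetaV k (suc s) (suc l))) → Resolving (Theta k (suc s) (suc l)) W →
    k ≤ length W
  resolving-length W resolves with all? (λ i → Any.any? (onShort? i) W)
  ... | yes all-hit = length-≥-labels W OnShort onShort-unique all-hit
  ... | no ¬all-hit with ¬∀⟶∃¬ k _ (λ i → Any.any? (onShort? i) W) ¬all-hit
  ...   | i , i-missed with resolves (short i 0F) (long 0F) (λ ())
  ...     | w , w∈W , _ , _ , Du , Dv , d≢d' = length-≥-labels W Label Label-unique labelled
    where
    Label : Fin k → ThetaV k (suc s) (suc l) → Set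
    Label x v = OnShort x v ⊎ (x ≡ i × OffShort v)

    Label-unique : ∀ {x y v} → Label x v → Label y v → x ≡ y
    Label-unique (inj₁ on-x) (inj₁ on-y) = onShort-unique on-x on-y
    Label-unique (inj₁ on-x) (inj₂ (_ , off)) = ⊥-elim (off _ on-x)
    Label-unique (inj₂ (_ , off)) (inj₁ on-y) = ⊥-elim (off _ on-y)
    Label-unique (inj₂ (x≡i , _)) (inj₂ (y≡i , _)) = trans x≡i (sym y≡i)

    labelled : ∀ x → Any (Label x) W
    labelled x with x ≟ i | Any.any? (onShort? x) W
    ... | yes x≡i | _ = lose w∈W (inj₂ (x≡i , resolver-off-short i-missed w∈W Du Dv d≢d'))
    ... | no _ | yes x-hit = Any.map inj₁ x-hit
    ... | no x≢i | no x-missed = ⊥-elim (x≢i (missed-short-paths-equal resolves x-missed i-missed))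

mainTheorem7 : (m s₁ s₂ : ℕ) → 3 ≤ m → 1 ≤ s₁ → s₁ < s₂ →
    (W : List (ThetaV (m ∸ 1) s₁ s₂)) → Unique W →
    Resolving (Theta (m ∸ 1) s₁ s₂) W → m ∸ 1 ≤ length W
mainTheorem7 m (suc s) (suc l) _ (s≤s z≤n) (s≤s s<l) W _ = resolving-length (<⇒≤ s<l) W
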